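{- Let $\mathfrak{S}$ be a finite board and let $I,J\subseteq\mathfrak{S}$. If $\mathbf{1}_I\boxtimes\mathbf{1}_I-\mathbf{1}_J\boxtimes\mathbf{1}_J\in V^+(\mathfrak{S}\boxtimes\mathfrak{S},\mathbb{Z})$, then $\mathbf{1}_I-\mathbf{1}_J\in V^+(\mathfrak{S},\mathbb{Z})$.
   Context: A board $\mathfrak{S}$ is a finite subset of $\mathbb{Z}^2$. For $P\in\mathfrak{S}$, $[P]$ denotes the function on $\mathfrak{S}$ equal to $1$ at $P$ and $0$ elsewhere; $\mathbf{1}_I$ is the indicator function of $I$. The set of moves $\mathscr{D}(\mathfrak{S})$ consists of all functions $\mathfrak{g}=[P]+[Q]-[R]$ where $P,Q,R\in\mathfrak{S}$ and $Q=P+v$, $R=P+2v$ for some $v\in\{(\pm1,0),(0,\pm1)\}$ (three consecutive squares in a row or column, in this order). $V^+(\mathfrak{S},\mathbb{Z})$ is the set of linear combinations of elements of $\mathscr{D}(\mathfrak{S})$ with non-negative integer coefficients. For $\mathfrak{g}=[P]+[Q]-[R]$, $|\mathfrak{g}|=[P]+[Q]+[R]$. Let $\mathfrak{S}\boxtimes\mathfrak{S}$ be the set of unordered pairs $\{A,B\}$ with $A,B\in\mathfrak{S}$ (allowing $A=B$), written $A\boxtimes B=B\boxtimes A$. For functions $g_1,g_2$ on $\mathfrak{S}$, $g_1\boxtimes g_2$ is the function on $\mathfrak{S}\boxtimes\mathfrak{S}$ whose value at $A\boxtimes B$ is $g_1(A)g_2(B)+g_1(B)g_2(A)$ if $A\neq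 B$ and $g_1(A)g_2(A)$ if $A=B$. Let $\mathscr{D}(\mathfrak{S}\boxtimes\mathfrak{S})=\{2[A]\boxtimes\mathfrak{g}:A\in\mathfrak{S},\ \mathfrak{g}\in\mathscr{D}(\mathfrak{S}),\ \mathfrak{g}(A)=0\}\cup\{|\mathfrak{g}|\boxtimes\mathfrak{g}:\mathfrak{g}\in\mathscr{D}(\mathfrak{S})\}$, and $V^+(\mathfrak{S}\boxtimes\mathfrak{S},\mathbb{Z})$ the set of linear combinations of elements of $\mathscr{D}(\mathfrak{S}\boxtimes\mathfrak{S})$ with non-negative integer coefficients. -}

module Defs where

open import Data.Integer using (ℤ; +_; _+_; _-_; _*_)
import Data.Integer as ℤ
open import Data.Product using (_×_; _,_; ∃)
open import Data.Product.Properties using (≡-dec)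
open import Data.List using (List; []; _∷_; map)
open import Data.List.Relation.Unary.All using (All)
open import Relation.Binary.PropositionalEquality using (_≡_)
open import Relation.Binary.Definitions using (DecidableEquality)
open import Relation.Nullary using (yes; no)

sumℤ : List ℤ → ℤ
sumℤ [] = + 0
sumℤ (x ∷ xs) = x + sumℤ xs

-- Points of ℤ², boards are finite lists of points (duplicates harmless).
Point : Set
Point = ℤ × ℤ

_≟ₚ_ : DecidableEquality Point
_≟ₚ_ = ≡-dec ℤ._≟_ ℤ._≟_

open import Data.List.Membership.DecPropositional _≟ₚ_ public using (_∈_; _∈?_)

Board : Set
Board = List Point

-- functions on a board (only their values on the board matter)
Fun : Set
Fun = Point → ℤ

-- functions on S ⊠ S, as functions of two arguments
Fun₂ : Set
Fun₂ = Point → Point → ℤ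

δ : Point → Fun
δ P X with P ≟ₚ X
... | yes _ = + 1
... | no  _ = + 0

𝟏 : List Point → Fun
𝟏 I X with X ∈? I
... | yes _ = + 1
... | no  _ = + 0

data Dir : Set where
  east west north south : Dir

vec : Dir → Point
vec east  = (+ 1 , + 0)
vec west  = (ℤ.- (+ 1) , + 0)
vec north = (+ 0 , + 1)
vec south = (+ 0 , ℤ.- (+ 1))

_+ₚ_ : Point → Point → Point
(a , b) +ₚ (c , d) = (a + c , b + d)

record Move : Set where
  constructor mv
  field
    base : Point
    dir  : Dir

pt₁ pt₂ pt₃ : Move → Point
pt₁ (mv P d) = P
pt₂ (mv P d) = P +ₚ vec d
pt₃ (mv P d) = (P +ₚ vec d) +ₚ vec d

⟦_⟧ : Move → Fun
⟦ m ⟧ X = (δ (pt₁ m) X + δ (pt₂ m) X) - δ (pt₃ m) X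

∣_∣ₘ : Move → Fun
∣ m ∣ₘ X = (δ (pt₁ m) X + δ (pt₂ m) X) + δ (pt₃ m) X

ValidMove : Board → Move → Set
ValidMove S m = pt₁ m ∈ S × pt₂ m ∈ S × pt₃ m ∈ S

-- f ∈ V⁺(𝔖,ℤ): f is a non-negative integer combination of moves
-- (a finite list of moves, repetitions allowed), equality as functions on 𝔖
V⁺ : Board → Fun → Set
V⁺ S f = ∃ λ (ms : List Move) → All (ValidMove S) ms ×
  (∀ X → X ∈ S → f X ≡ sumℤ (map (λ m → ⟦ m ⟧ X) ms))

_⊠_ : Fun → Fun → Fun₂
(g₁ ⊠ g₂) A B with A ≟ₚ B
... | yes _ = g₁ A * g₂ A
... | no  _ = g₁ A * g₂ B + g₁ B * g₂ A

data PairGen : Set where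
  single : Point → Move → PairGen
  double : Move → PairGen

⟦_⟧₂ : PairGen → Fun₂
⟦ single A g ⟧₂ = (λ X → + 2 * δ A X) ⊠ ⟦ g ⟧
⟦ double g ⟧₂ = ∣ g ∣ₘ ⊠ ⟦ g ⟧

ValidPairGen : Board → PairGen → Set
ValidPairGen S (single A g) = A ∈ S × ValidMove S g × ⟦ g ⟧ A ≡ + 0
ValidPairGen S (double g) = ValidMove S g

V⁺₂ : Board → Fun₂ → Set
V⁺₂ S F = ∃ λ (gs : List PairGen) → All (ValidPairGen S) gs ×
  (∀ A B → A ∈ S → B ∈ S → F A B ≡ sumℤ (map (λ γ → ⟦ γ ⟧₂ A B) gs))

module Submission where

-- Restrict everything to the diagonal {X ⊠ X : X ∈ 𝔖}.
-- On the diagonal, (f ⊠ g)(X ⊠ X) = f(X)·g(X); since indicators are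
-- idempotent, the hypothesis function 𝟏_I ⊠ 𝟏_I − 𝟏_J ⊠ 𝟏_J restricts
-- to 𝟏_I − 𝟏_J.  The generators of 𝒟(𝔖 ⊠ 𝔖) restrict as follows:
--   * 2[A] ⊠ 𝔤 with 𝔤(A) = 0 restricts to 2[A]·𝔤 = 0;
--   * |𝔤| ⊠ 𝔤 restricts to |𝔤|·𝔤 = 𝔤, because the three squares of a
--     move are pairwise distinct, so on each square |𝔤| = 1 and 𝔤 = ±1.
-- Hence a decomposition of the hypothesis function into generators yields,
-- on the diagonal, a decomposition of 𝟏_I − 𝟏_J as the sum of the moves 𝔤
-- occurring in the generators |𝔤| ⊠ 𝔤.

open import Defs
open import Data.Integer using (ℤ; +_; _+_; _-_; _*_)
open import Data.Integer.Properties using (+-assoc; +-identityˡ; +-0-abelianGroup)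
open import Algebra.Bundles using (AbelianGroup)
open import Algebra.Properties.Group (AbelianGroup.group +-0-abelianGroup)
  using (identityʳ-unique)
open import Data.List.Relation.Binary.Subset.Propositional using (_⊆_)
open import Data.Product using (_,_; proj₁; proj₂)
open import Data.List using (List; []; _∷_; map)
open import Data.List.Relation.Unary.All using (All; []; _∷_)
open import Relation.Binary.PropositionalEquality
  using (_≡_; _≢_; refl; sym; trans; cong; cong₂; module ≡-Reasoning)
open import Relation.Nullary using (yes; no)
open import Data.Empty using (⊥-elim)

origin : Point
origin = (+ 0 , + 0)

+ₚ-moves : ∀ P v → v ≢ origin → P ≢ P +ₚ v
+ₚ-moves (a , b) (c , d) v≢0 P≡P+v =
  v≢0 (cong₂ _,_ (identityʳ-unique a c (sym (cong proj₁ P≡P+v)))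
                 (identityʳ-unique b d (sym (cong proj₂ P≡P+v))))

+ₚ-assoc : ∀ P Q R → (P +ₚ Q) +ₚ R ≡ P +ₚ (Q +ₚ R)
+ₚ-assoc (a , b) (c , d) (e , f) = cong₂ _,_ (+-assoc a c e) (+-assoc b d f)

vec≢origin : ∀ d → vec d ≢ origin
vec≢origin east  ()
vec≢origin west  ()
vec≢origin north ()
vec≢origin south ()

vec+vec≢origin : ∀ d → vec d +ₚ vec d ≢ origin
vec+vec≢origin east  ()
vec+vec≢origin west  ()
vec+vec≢origin north ()
vec+vec≢origin south ()

record Distinct (P Q R : Point) : Set where
  field
    P≢Q : P ≢ Q
    P≢R : P ≢ R
    Q≢R : Q ≢ R

move-distinct : ∀ m → Distinct (pt₁ m) (pt₂ m) (pt₃ m)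
move-distinct (mv P d) = record
  { P≢Q = +ₚ-moves P (vec d) (vec≢origin d)
  ; P≢R = λ P≡R → +ₚ-moves P (vec d +ₚ vec d) (vec+vec≢origin d)
                    (trans P≡R (+ₚ-assoc P (vec d) (vec d)))
  ; Q≢R = +ₚ-moves (P +ₚ vec d) (vec d) (vec≢origin d)
  }

-- On three distinct squares, ([P]+[Q]+[R])·([P]+[Q]−[R]) = [P]+[Q]−[R]:
-- at each point at most one of the deltas is 1, and (±1)·1 = ±1.
support-times-move : ∀ {P Q R} → Distinct P Q R → ∀ X →
  ((δ P X + δ Q X) + δ R X) * ((δ P X + δ Q X) - δ R X) ≡ (δ P X + δ Q X) - δ R X
support-times-move {P} {Q} {R} dist X with P ≟ₚ X | Q ≟ₚ X | R ≟ₚ X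
... | yes P≡X | yes Q≡X | _       = ⊥-elim (Distinct.P≢Q dist (trans P≡X (sym Q≡X)))
... | yes P≡X | no _    | yes R≡X = ⊥-elim (Distinct.P≢R dist (trans P≡X (sym R≡X)))
... | no _    | yes Q≡X | yes R≡X = ⊥-elim (Distinct.Q≢R dist (trans Q≡X (sym R≡X)))
... | yes _   | no _    | no _    = refl
... | no _    | yes _   | no _    = refl
... | no _    | no _    | yes _   = refl
... | no _    | no _    | no _    = refl

∣move∣-times-move : ∀ m X → ∣ m ∣ₘ X * ⟦ m ⟧ X ≡ ⟦ m ⟧ X
∣move∣-times-move m = support-times-move (move-distinct m)

point-times-move : ∀ A g X → ⟦ g ⟧ A ≡ + 0 → (+ 2 * δ A X) * ⟦ g ⟧ X ≡ + 0
point-times-move A g X g[A]≡0 with A ≟ₚ X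
... | yes refl = cong (+ 2 * + 1 *_) g[A]≡0
... | no _     = refl

𝟏-idempotent : ∀ I X → 𝟏 I X * 𝟏 I X ≡ 𝟏 I X
𝟏-idempotent I X with X ∈? I
... | yes _ = refl
... | no _  = refl

⊠-diagonal : ∀ f g X → (f ⊠ g) X X ≡ f X * g X
⊠-diagonal f g X with X ≟ₚ X
... | yes _   = refl
... | no X≢X  = ⊥-elim (X≢X refl)

-- The moves 𝔤 of the generators |𝔤| ⊠ 𝔤 in a list of generators; the
-- generators 2[A] ⊠ 𝔤 vanish on the diagonal and are dropped.
diagonalMoves : List PairGen → List Move
diagonalMoves []                 = []
diagonalMoves (single _ _ ∷ γs)  = diagonalMoves γs
diagonalMoves (double g ∷ γs)    = g ∷ diagonalMoves γs

diagonalMoves-valid : ∀ {S} γs → All (ValidPairGen S) γs →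
  All (ValidMove S) (diagonalMoves γs)
diagonalMoves-valid []               []       = []
diagonalMoves-valid (single _ _ ∷ γs) (_ ∷ vs) = diagonalMoves-valid γs vs
diagonalMoves-valid (double _ ∷ γs)   (v ∷ vs) = v ∷ diagonalMoves-valid γs vs

diagonal-sum : ∀ {S} γs → All (ValidPairGen S) γs → ∀ X →
  sumℤ (map (λ γ → ⟦ γ ⟧₂ X X) γs) ≡ sumℤ (map (λ m → ⟦ m ⟧ X) (diagonalMoves γs))
diagonal-sum [] [] X = refl
diagonal-sum (single A g ∷ γs) ((_ , _ , g[A]≡0) ∷ vs) X = begin
    ⟦ single A g ⟧₂ X X + rest   ≡⟨ cong (_+ rest) single-vanishes ⟩
    + 0 + rest                   ≡⟨ +-identityˡ rest ⟩
    rest                         ≡⟨ diagonal-sum γs vs X ⟩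
    sumℤ (map (λ m → ⟦ m ⟧ X) (diagonalMoves γs)) ∎
  where
  open ≡-Reasoning
  rest : ℤ
  rest = sumℤ (map (λ γ → ⟦ γ ⟧₂ X X) γs)
  single-vanishes : ⟦ single A g ⟧₂ X X ≡ + 0
  single-vanishes = trans (⊠-diagonal (λ Y → + 2 * δ A Y) ⟦ g ⟧ X)
                          (point-times-move A g X g[A]≡0)
diagonal-sum (double g ∷ γs) (_ ∷ vs) X =
  cong₂ _+_ (trans (⊠-diagonal ∣ g ∣ₘ ⟦ g ⟧ X) (∣move∣-times-move g X))
            (diagonal-sum γs vs X)

𝟏⊠𝟏-diagonal : ∀ I X → (𝟏 I ⊠ 𝟏 I) X X ≡ 𝟏 I X
𝟏⊠𝟏-diagonal I X = trans (⊠-diagonal (𝟏 I) (𝟏 I) X) (𝟏-idempotent I X)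

mainTheorem1 : (S I J : Board) → I ⊆ S → J ⊆ S →
    V⁺₂ S (λ A B → (𝟏 I ⊠ 𝟏 I) A B - (𝟏 J ⊠ 𝟏 J) A B) →
    V⁺ S (λ X → 𝟏 I X - 𝟏 J X)
mainTheorem1 S I J _ _ (γs , valid , decomposition) =
  diagonalMoves γs , diagonalMoves-valid γs valid , on-board
  where
  open ≡-Reasoning
  on-board : ∀ X → X ∈ S →
    𝟏 I X - 𝟏 J X ≡ sumℤ (map (λ m → ⟦ m ⟧ X) (diagonalMoves γs))
  on-board X X∈S = begin
    𝟏 I X - 𝟏 J X
      ≡⟨ sym (cong₂ _-_ (𝟏⊠𝟏-diagonal I X) (𝟏⊠𝟏-diagonal J X)) ⟩
    (𝟏 I ⊠ 𝟏 I) X X - (𝟏 J ⊠ 𝟏 J) X X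
      ≡⟨ decomposition X X X∈S X∈S ⟩
    sumℤ (map (λ γ → ⟦ γ ⟧₂ X X) γs)
      ≡⟨ diagonal-sum γs valid X ⟩
    sumℤ (map (λ m → ⟦ m ⟧ X) (diagonalMoves γs)) ∎
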